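{- For every integer $n\geq 3$, $\lceil \log_2 n\rceil \leq \mathrm{sat}^*(n,\mathcal{N})\leq 2n$.
   Context: $\mathcal{N}$ is the four-element poset on $\{A,B,C,D\}$ whose only strict relations are $A<B$, $C<B$, $C<D$ (so $A\parallel C$, $A\parallel D$, $B\parallel D$). $\mathcal{B}_n$ is the Boolean lattice $(2^{[n]},\subseteq)$. A poset $\mathcal{P}'=(P',\le')$ is an induced subposet of $\mathcal{P}=(P,\le)$ if there is an injection $f:P'\to P$ with $u\le' v$ iff $f(u)\le f(v)$. A family $\mathcal{F}\subseteq 2^{[n]}$ (ordered by inclusion) is induced-$\mathcal{P}$-saturated in $\mathcal{B}_n$ if it contains no induced copy of $\mathcal{P}$, but every $\mathcal{F}'$ with $\mathcal{F}\subsetneq\mathcal{F}'\subseteq 2^{[n]}$ contains an induced copy of $\mathcal{P}$. $\mathrm{sat}^*(n,\mathcal{P})$ is the minimum size of an induced-$\mathcal{P}$-saturated family in $\mathcal{B}_n$. -}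

module Defs where

open import Data.Nat using (ℕ; _≤_)
open import Data.Fin using (Fin; zero; suc)
open import Data.Fin.Subset using (Subset; _⊆_)
open import Data.List using (List; length)
open import Data.List.Membership.Propositional using (_∈_; _∉_)
open import Data.List.Relation.Unary.Unique.Propositional using (Unique)
open import Data.Product using (Σ; ∃; _×_)
open import Function.Definitions using (Injective)
open import Function.Bundles using (_⇔_)
open import Relation.Binary.PropositionalEquality using (_≡_)
open import Relation.Nullary using (¬_)

pattern A = zero
pattern B = suc zero
pattern C = suc (suc zero)
pattern D = suc (suc (suc zero))

data _≤𝒩_ : Fin 4 → Fin 4 → Set where
  refl𝒩 : ∀ {x} → x ≤𝒩 x
  A<B : A ≤𝒩 B
  C<B : C ≤𝒩 B
  C<D : C ≤𝒩 D

-- A family of subsets of [n] = Fin n, given as a list (a finite family;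
-- a genuine family is a duplicate-free list, its size is the length).
Family : ℕ → Set
Family n = List (Subset n)

HasInduced𝒩 : ∀ {n} → Family n → Set
HasInduced𝒩 {n} F =
  Σ (Fin 4 → Subset n) λ f →
    Injective _≡_ _≡_ f ×
    (∀ i → f i ∈ F) ×
    (∀ u v → (u ≤𝒩 v) ⇔ (f u ⊆ f v))

IsSaturated : ∀ {n} → Family n → Set
IsSaturated {n} F =
  Unique F ×
  ¬ HasInduced𝒩 F ×
  (∀ (F' : Family n) →
     (∀ S → S ∈ F → S ∈ F') →
     (∃ λ S → S ∈ F' × S ∉ F) →
     HasInduced𝒩 F')

IsSatStar : ℕ → ℕ → Set
IsSatStar n m =
  (Σ (Family n) λ F → IsSaturated F × length F ≡ m) ×
  (∀ (F : Family n) → IsSaturated F → m ≤ length F)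

module Submission where

-- In a saturated family F every point i lies in some member (otherwise add
-- T₀ ∪ {i} for a largest member T₀), and any two points i ≠ j are separated by some member
-- (otherwise add T₀ ∖ {i} for a smallest member T₀ containing i).  In both cases the new set is
-- comparable with T₀ and is related to every other member exactly as T₀ is.  Since 𝒩 has no two
-- comparable elements that are related in the same way to the remaining ones, a copy of 𝒩 through
-- the new set yields a copy through T₀ instead, so adding the set creates no copy, contradicting
-- saturation.  Hence the membership vectors of the n points in {0,1}^|F| are distinct: n ≤ 2^|F|.
--
-- The prefixes {x ∣ x < k}, 0 ≤ k ≤ n, together with the singletons {x}, x ≥ 1,
-- form a saturated family of size 2n.  In a copy of 𝒩 the set C is nonempty and has the two
-- incomparable strict supersets B and D, which would both have to be prefixes.  Any other set S
-- completes a copy (A, B, C, D) = ({0}, [0,x], {x}, S) if 0 ∉ S and S contains x < y, and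
-- ({m}, S, [0,j), [0,j]) if j is the least element missing from S and S contains some m > j.
--
-- The minimum sat*(n, 𝒩) exists constructively because saturation is decidable and the families
-- of a given length can be enumerated.

open import Defs
open import Data.Bool using (Bool)
open import Data.Bool.Properties using () renaming (_≟_ to _≟ᵇ_)
open import Data.Empty using (⊥; ⊥-elim)
open import Data.Fin as Fin using (Fin; toℕ; fromℕ<; funToFin; finToFun)
import Data.Fin.Properties as Fin
open import Data.Fin.Properties using (2↔Bool; finToFun-funToFin)
open import Data.Fin.Subset using (Subset; inside; outside; _⊆_; _⊈_; _⊂_; _∪_; _∩_; ∁; ⁅_⁆; ∣_∣)
  renaming (_∈_ to _∈ˢ_; _∉_ to _∉ˢ_; ⊥ to ⊥ˢ)
open import Data.Fin.Subset.Properties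
  using ( _⊆?_; ⊆-reflexive; ⊆-trans; ⊆-antisym; anySubset?; nonempty?; Empty-unique; ∉⊥; in⊆in; drop-there
        ; p⊂q⇒∣p∣<∣q∣; p⊆p∪q; x∈p∪q⁺; x∈p∪q⁻; p∩q⊆p; x∈p∩q⁺; x∈p∩q⁻; x∈∁p⇒x∉p; x∉p⇒x∈∁p
        ; x∈⁅x⁆; x∈⁅y⁆⇒x≡y; x≢y⇒x∉⁅y⁆ )
  renaming (_∈?_ to _∈ˢ?_)
open import Data.List as List using (List; []; _∷_; _++_; length; filter; applyUpTo; tabulate)
import Data.List.Properties as List
open import Data.List.Extrema.Nat using (argmin; argmax; argmin-all; argmax-all; f[argmin]≤f[xs]; f[xs]≤f[argmax])
open import Data.List.Membership.Propositional using (_∈_; _∉_; find; lose)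
open import Data.List.Membership.Propositional.Properties
  using (∈-filter⁺; ∈-filter⁻; ∈-++⁺ˡ; ∈-++⁺ʳ; ∈-++⁻; ∈-applyUpTo⁺; ∈-applyUpTo⁻; ∈-tabulate⁺; ∈-tabulate⁻)
import Data.List.Relation.Unary.All as All
open import Data.List.Relation.Unary.Any as Any using (Any; here; there; any?)
open import Data.List.Relation.Unary.Any.Properties using (lookup-index)
open import Data.List.Relation.Unary.Unique.Propositional using (Unique)
import Data.List.Relation.Unary.Unique.Propositional.Properties as Unique
open import Data.Nat as ℕ using (ℕ; zero; suc; _+_; _*_; _^_; _≤_; _<_; z≤n; s≤s)
import Data.Nat.Properties as ℕ
open import Data.Nat.Logarithm using (⌈log₂_⌉; ⌈log₂⌉-mono-≤; ⌈log₂2^n⌉≡n)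
open import Data.Product using (Σ; ∃; ∃₂; _×_; _,_; proj₁; proj₂)
open import Data.Sum using (_⊎_; inj₁; inj₂; [_,_])
open import Data.Vec as Vec using (Vec; []; _∷_; lookup; toList; fromList) renaming (here to hereˢ; there to thereˢ)
import Data.Vec.Properties as Vec
open import Data.Vec.Functional using (updateAt)
open import Data.Vec.Functional.Properties using (updateAt-updates; updateAt-minimal)
open import Function using (_∘_; id; flip; const; case_of_)
open import Function.Bundles using (_⇔_; mk⇔; Equivalence; _↣_; Injection)
open Equivalence using (to; from)
import Function.Properties.Equivalence as ⇔
open import Function.Properties.Inverse using (↔⇒↣; ↔-sym)
open import Function.Definitions using (Injective)
open import Level using (0ℓ)
open import Relation.Binary using (DecidableEquality)
open import Relation.Binary.PropositionalEquality
  using (_≡_; _≢_; refl; sym; trans; cong; cong₂; subst; subst₂; _≗_; module ≡-Reasoning)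
open import Relation.Nullary using (¬_; Dec; yes; no; contradiction)
open import Relation.Nullary.Decidable using (map′; _×-dec_; _⊎-dec_; _→-dec_; ¬?; decidable-stable)
open import Relation.Unary using (Pred; Decidable)

_⇔-dec_ : ∀ {P Q : Set} → Dec P → Dec Q → Dec (P ⇔ Q)
P? ⇔-dec Q? = map′ (λ (P→Q , Q→P) → mk⇔ P→Q Q→P) (λ P⇔Q → to P⇔Q , from P⇔Q)
                   ((P? →-dec Q?) ×-dec (Q? →-dec P?))

Searchable : Set → Set₁
Searchable X = ∀ {P : Pred X 0ℓ} → Decidable P → Dec (∃ P)

searchable⇒all? : ∀ {X} → Searchable X → ∀ {P : Pred X 0ℓ} → Decidable P → Dec (∀ x → P x)
searchable⇒all? search P? =
  map′ (λ ¬∃¬P x → decidable-stable (P? x) (¬∃¬P ∘ (x ,_))) (λ ∀P (x , ¬Px) → ¬Px (∀P x))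
       (¬? (search (¬? ∘ P?)))

vec-searchable : ∀ {X} → Searchable X → ∀ k → Searchable (Vec X k)
vec-searchable _ zero P? = map′ ([] ,_) (λ { ([] , p) → p }) (P? [])
vec-searchable search (suc k) P? =
  map′ (λ (x , xs , p) → x ∷ xs , p) (λ { (x ∷ xs , p) → x , xs , p })
       (search λ x → vec-searchable search k (P? ∘ (x ∷_)))

least-witness : ∀ {P : Pred ℕ 0ℓ} → Decidable P → ∀ {k} → P k → ∃ λ m → P m × (∀ {j} → P j → m ≤ j)
least-witness {P} P? {k} Pk = [ id , (λ none → contradiction Pk (none k ℕ.≤-refl)) ] (search (suc k))
  where
  search : ∀ b → (∃ λ m → P m × (∀ {j} → P j → m ≤ j)) ⊎ (∀ j → j < b → ¬ P j)
  search zero = inj₂ λ _ ()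
  search (suc b) with search b
  ... | inj₁ least = inj₁ least
  ... | inj₂ none-below-b with P? b
  ...   | yes Pb = inj₁ (b , Pb , λ Pj → ℕ.≮⇒≥ λ j<b → none-below-b _ j<b Pj)
  ...   | no ¬Pb = inj₂ λ j j<1+b →
    [ none-below-b j , (λ { refl → ¬Pb }) ] (ℕ.m<1+n⇒m<n∨m≡n j<1+b)

module _ {X : Set} (f : X → ℕ) where

  minimal-member : ∀ {P : Pred X 0ℓ} {xs} → Decidable P → Any P xs →
    ∃ λ y → y ∈ xs × P y × (∀ {z} → z ∈ xs → P z → f y ≤ f z)
  minimal-member {P} {xs} P? some =
    let (x , x∈xs , Px) = find some
        (y∈xs , Py) = argmin-all f {P = λ y → y ∈ xs × P y} (x∈xs , Px) (All.tabulate (∈-filter⁻ P?))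
    in argmin f x (filter P? xs) , y∈xs , Py ,
       λ z∈xs Pz → All.lookup (f[argmin]≤f[xs] x (filter P? xs)) (∈-filter⁺ P? z∈xs Pz)

  maximal-member : ∀ {x xs} → x ∈ xs → ∃ λ y → y ∈ xs × (∀ {z} → z ∈ xs → f z ≤ f y)
  maximal-member {x} {xs} x∈xs =
    argmax f x xs , argmax-all f {P = _∈ xs} x∈xs (All.tabulate id) ,
    All.lookup (f[xs]≤f[argmax] x xs)

_≟ˢ_ : ∀ {n} → DecidableEquality (Subset n)
_≟ˢ_ = Vec.≡-dec _≟ᵇ_

p⊆q∧p≢q⇒p⊂q : ∀ {n} {p q : Subset n} → p ⊆ q → p ≢ q → p ⊂ q
p⊆q∧p≢q⇒p⊂q {p = p} {q} p⊆q p≢q with Fin.any? (λ x → x ∈ˢ? q ×-dec ¬? (x ∈ˢ? p))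
... | yes (x , x∈q , x∉p) = p⊆q , x , x∈q , x∉p
... | no ¬new = contradiction (⊆-antisym p⊆q q⊆p) p≢q
  where
  q⊆p : q ⊆ p
  q⊆p {x} x∈q = decidable-stable (x ∈ˢ? p) (¬new ∘ (x ,_) ∘ (x∈q ,_))

⊆-cong : ∀ {n} {X X' Y Y' : Subset n} → X ≡ X' → Y ≡ Y' → X ⊆ Y ⇔ X' ⊆ Y'
⊆-cong refl refl = ⇔.refl

∈∧∉⇒⊈ : ∀ {n} {x : Fin n} {X Y} → x ∈ˢ X → x ∉ˢ Y → X ⊈ Y
∈∧∉⇒⊈ x∈X x∉Y X⊆Y = x∉Y (X⊆Y x∈X)

x∈p⇒⁅x⁆⊆p : ∀ {n} {x : Fin n} {p} → x ∈ˢ p → ⁅ x ⁆ ⊆ p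
x∈p⇒⁅x⁆⊆p {x = x} {p} x∈p y∈⁅x⁆ = subst (_∈ˢ p) (sym (x∈⁅y⁆⇒x≡y x y∈⁅x⁆)) x∈p

prefix : ∀ {n} → ℕ → Subset n
prefix {zero}  _       = []
prefix {suc n} zero    = ⊥ˢ
prefix {suc n} (suc k) = inside ∷ prefix k

x∈prefix⁺ : ∀ {n k} {x : Fin n} → toℕ x < k → x ∈ˢ prefix k
x∈prefix⁺ {x = Fin.zero}  (s≤s _)   = hereˢ
x∈prefix⁺ {x = Fin.suc x} (s≤s x<k) = thereˢ (x∈prefix⁺ x<k)

x∈prefix⁻ : ∀ {n k} {x : Fin n} → x ∈ˢ prefix k → toℕ x < k
x∈prefix⁻ {suc n} {zero}  x∈⊥               = contradiction x∈⊥ ∉⊥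
x∈prefix⁻ {suc n} {suc k} hereˢ              = s≤s z≤n
x∈prefix⁻ {suc n} {suc k} (thereˢ x∈prefix) = s≤s (x∈prefix⁻ x∈prefix)

prefix-mono : ∀ {n k l} → k ≤ l → prefix {n} k ⊆ prefix l
prefix-mono k≤l x∈prefix = x∈prefix⁺ (ℕ.<-≤-trans (x∈prefix⁻ x∈prefix) k≤l)

prefix-chain : ∀ {n} k l → prefix {n} k ⊆ prefix l ⊎ prefix {n} l ⊆ prefix k
prefix-chain k l with ℕ.≤-total k l
... | inj₁ k≤l = inj₁ (prefix-mono k≤l)
... | inj₂ l≤k = inj₂ (prefix-mono l≤k)

prefix-or-gap : ∀ {n} (S : Subset n) →
  (∃ λ k → k ≤ n × S ≡ prefix k) ⊎
  (∃₂ λ j m → j ∉ˢ S × m ∈ˢ S × j Fin.< m × prefix (toℕ j) ⊆ S)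
prefix-or-gap [] = inj₁ (0 , z≤n , refl)
prefix-or-gap (outside ∷ S) with nonempty? S
... | yes (m , m∈S) = inj₂ (Fin.zero , Fin.suc m , (λ ()) , thereˢ m∈S , s≤s z≤n , ⊥-elim ∘ ∉⊥)
... | no empty = inj₁ (0 , z≤n , cong (outside ∷_) (Empty-unique empty))
prefix-or-gap (inside ∷ S) with prefix-or-gap S
... | inj₁ (k , k≤n , refl) = inj₁ (suc k , s≤s k≤n , refl)
... | inj₂ (j , m , j∉S , m∈S , j<m , prefix⊆S) =
  inj₂ (Fin.suc j , Fin.suc m , j∉S ∘ drop-there , thereˢ m∈S , s≤s j<m , in⊆in prefix⊆S)

empty-or-singleton-or-pair : ∀ {n} (S : Subset n) →
  S ≡ ⊥ˢ ⊎ (∃ λ x → S ≡ ⁅ x ⁆) ⊎ (∃₂ λ x y → x ∈ˢ S × y ∈ˢ S × x Fin.< y)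
empty-or-singleton-or-pair [] = inj₁ refl
empty-or-singleton-or-pair (outside ∷ S) with empty-or-singleton-or-pair S
... | inj₁ S≡⊥ = inj₁ (cong (outside ∷_) S≡⊥)
... | inj₂ (inj₁ (x , S≡⁅x⁆)) = inj₂ (inj₁ (Fin.suc x , cong (outside ∷_) S≡⁅x⁆))
... | inj₂ (inj₂ (x , y , x∈S , y∈S , x<y)) =
  inj₂ (inj₂ (Fin.suc x , Fin.suc y , thereˢ x∈S , thereˢ y∈S , s≤s x<y))
empty-or-singleton-or-pair (inside ∷ S) with empty-or-singleton-or-pair S
... | inj₁ S≡⊥ = inj₂ (inj₁ (Fin.zero , cong (inside ∷_) S≡⊥))
... | inj₂ (inj₁ (y , refl)) = inj₂ (inj₂ (Fin.zero , Fin.suc y , hereˢ , thereˢ (x∈⁅x⁆ y) , s≤s z≤n))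
... | inj₂ (inj₂ (x , _ , x∈S , _)) = inj₂ (inj₂ (Fin.zero , Fin.suc x , hereˢ , thereˢ x∈S , s≤s z≤n))

-- The poset 𝒩 and its induced copies

_≤𝒩?_ : (u v : Fin 4) → Dec (u ≤𝒩 v)
A ≤𝒩? A = yes refl𝒩
A ≤𝒩? B = yes A<B
A ≤𝒩? C = no λ ()
A ≤𝒩? D = no λ ()
B ≤𝒩? A = no λ ()
B ≤𝒩? B = yes refl𝒩
B ≤𝒩? C = no λ ()
B ≤𝒩? D = no λ ()
C ≤𝒩? A = no λ ()
C ≤𝒩? B = yes C<B
C ≤𝒩? C = yes refl𝒩
C ≤𝒩? D = yes C<D
D ≤𝒩? A = no λ ()
D ≤𝒩? B = no λ ()
D ≤𝒩? C = no λ ()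
D ≤𝒩? D = yes refl𝒩

≤𝒩-antisym : ∀ {u v} → u ≤𝒩 v → v ≤𝒩 u → u ≡ v
≤𝒩-antisym refl𝒩 _ = refl

Twins𝒩 : Fin 4 → Fin 4 → Set
Twins𝒩 u v = ∀ w → w ≢ u → w ≢ v → (w ≤𝒩 u ⇔ w ≤𝒩 v) × (u ≤𝒩 w ⇔ v ≤𝒩 w)

twins𝒩-sym : ∀ {u v} → Twins𝒩 u v → Twins𝒩 v u
twins𝒩-sym tw w w≢v w≢u = let (below , above) = tw w w≢u w≢v in ⇔.sym below , ⇔.sym above

comparable⇒¬twins𝒩 : ∀ {u v} → u ≢ v → u ≤𝒩 v → ¬ Twins𝒩 u v
comparable⇒¬twins𝒩 u≢v refl𝒩 _ = u≢v refl
comparable⇒¬twins𝒩 _ A<B tw with from (proj₁ (tw C (λ ()) (λ ()))) C<B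
... | ()
comparable⇒¬twins𝒩 _ C<B tw with from (proj₁ (tw A (λ ()) (λ ()))) A<B
... | ()
comparable⇒¬twins𝒩 _ C<D tw with to (proj₂ (tw B (λ ()) (λ ()))) C<B
... | ()

module _ {n : ℕ} where

  Induces𝒩 : (Fin 4 → Subset n) → Set
  Induces𝒩 f = ∀ u v → u ≤𝒩 v ⇔ f u ⊆ f v

  induces𝒩? : ∀ f → Dec (Induces𝒩 f)
  induces𝒩? f = Fin.all? λ u → Fin.all? λ v → (u ≤𝒩? v) ⇔-dec (f u ⊆? f v)

  induces𝒩-resp-≗ : ∀ {f g} → f ≗ g → Induces𝒩 f → Induces𝒩 g
  induces𝒩-resp-≗ {f} {g} f≗g ind u v =
    subst₂ (λ X Y → u ≤𝒩 v ⇔ X ⊆ Y) (f≗g u) (f≗g v) (ind u v)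

  induces𝒩⇒injective : ∀ {f} → Induces𝒩 f → Injective _≡_ _≡_ f
  induces𝒩⇒injective ind {u} {v} fu≡fv =
    ≤𝒩-antisym (from (ind u v) (⊆-reflexive fu≡fv))
               (from (ind v u) (⊆-reflexive (sym fu≡fv)))

  has𝒩 : ∀ {F f} → (∀ u → f u ∈ F) → Induces𝒩 f → HasInduced𝒩 F
  has𝒩 f∈F ind = _ , induces𝒩⇒injective ind , f∈F , ind

  has𝒩-mono : ∀ {F G : Family n} → (∀ {S} → S ∈ F → S ∈ G) → HasInduced𝒩 F → HasInduced𝒩 G
  has𝒩-mono F⊆G (f , inj , f∈F , ind) = f , inj , F⊆G ∘ f∈F , ind

  has𝒩-from : ∀ {F} {a b c d : Subset n} → a ∈ F → b ∈ F → c ∈ F → d ∈ F →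
    a ⊆ b → c ⊆ b → c ⊆ d →
    a ⊈ c → a ⊈ d → b ⊈ a → b ⊈ c → b ⊈ d → c ⊈ a → d ⊈ a → d ⊈ b → d ⊈ c →
    HasInduced𝒩 F
  has𝒩-from {F} {a} {b} {c} {d} a∈ b∈ c∈ d∈ a⊆b c⊆b c⊆d a⊈c a⊈d b⊈a b⊈c b⊈d c⊈a d⊈a d⊈b d⊈c =
    has𝒩 {f = f} f∈F ind
    where
    f : Fin 4 → Subset n
    f = lookup (a ∷ b ∷ c ∷ d ∷ [])
    f∈F : ∀ u → f u ∈ F
    f∈F A = a∈
    f∈F B = b∈
    f∈F C = c∈
    f∈F D = d∈
    holds : ∀ {u v} {X Y : Subset n} → u ≤𝒩 v → X ⊆ Y → u ≤𝒩 v ⇔ X ⊆ Y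
    holds u≤v X⊆Y = mk⇔ (λ _ {_} → X⊆Y) (λ _ → u≤v)
    fails : ∀ {u v} {X Y : Subset n} → ¬ u ≤𝒩 v → X ⊈ Y → u ≤𝒩 v ⇔ X ⊆ Y
    fails u≰v X⊈Y = mk⇔ (⊥-elim ∘ u≰v) (⊥-elim ∘ X⊈Y)
    ind : Induces𝒩 f
    ind A A = holds refl𝒩 id
    ind A B = holds A<B a⊆b
    ind A C = fails (λ ()) a⊈c
    ind A D = fails (λ ()) a⊈d
    ind B A = fails (λ ()) b⊈a
    ind B B = holds refl𝒩 id
    ind B C = fails (λ ()) b⊈c
    ind B D = fails (λ ()) b⊈d
    ind C A = fails (λ ()) c⊈a
    ind C B = holds C<B c⊆b
    ind C C = holds refl𝒩 id
    ind C D = holds C<D c⊆d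
    ind D A = fails (λ ()) d⊈a
    ind D B = fails (λ ()) d⊈b
    ind D C = fails (λ ()) d⊈c
    ind D D = holds refl𝒩 id

-- Deciding saturation

module _ {n : ℕ} where

  open import Data.List.Membership.DecPropositional (_≟ˢ_ {n}) using (_∈?_)
  open import Data.List.Relation.Unary.Unique.DecPropositional (_≟ˢ_ {n}) using (unique?)

  has𝒩? : (F : Family n) → Dec (HasInduced𝒩 F)
  has𝒩? F = map′ (λ (v , v∈F , ind) → has𝒩 v∈F ind) fromEmbedding
    (vec-searchable anySubset? 4 λ v → Fin.all? (λ u → lookup v u ∈? F) ×-dec induces𝒩? (lookup v))
    where
    fromEmbedding : HasInduced𝒩 F → ∃ λ v → (∀ u → lookup v u ∈ F) × Induces𝒩 (lookup v)
    fromEmbedding (f , _ , f∈F , ind) =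
      Vec.tabulate f ,
      (λ u → subst (_∈ F) (sym (Vec.lookup∘tabulate f u)) (f∈F u)) ,
      induces𝒩-resp-≗ (sym ∘ Vec.lookup∘tabulate f) ind

  AddingCreates𝒩 : Family n → Set
  AddingCreates𝒩 F = ∀ S → S ∈ F ⊎ HasInduced𝒩 (S ∷ F)

  saturated⇔ : ∀ {F} → IsSaturated F ⇔ (Unique F × ¬ HasInduced𝒩 F × AddingCreates𝒩 F)
  saturated⇔ {F} = mk⇔ (λ (u , free , sat) → u , free , creates sat)
                       (λ (u , free , creating) → u , free , saturates creating)
    where
    creates : (∀ F' → (∀ S → S ∈ F → S ∈ F') → (∃ λ S → S ∈ F' × S ∉ F) → HasInduced𝒩 F') →
              AddingCreates𝒩 F
    creates sat S with S ∈? F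
    ... | yes S∈F = inj₁ S∈F
    ... | no  S∉F = inj₂ (sat (S ∷ F) (λ _ → there) (S , here refl , S∉F))
    saturates : AddingCreates𝒩 F →
                ∀ F' → (∀ S → S ∈ F → S ∈ F') → (∃ λ S → S ∈ F' × S ∉ F) → HasInduced𝒩 F'
    saturates creating F' F⊆F' (S , S∈F' , S∉F) =
      [ flip contradiction S∉F , has𝒩-mono (λ { (here refl) → S∈F' ; (there T∈F) → F⊆F' _ T∈F }) ]
      (creating S)

  saturated⇒adding-creates𝒩 : ∀ {F S} → IsSaturated F → S ∉ F → HasInduced𝒩 (S ∷ F)
  saturated⇒adding-creates𝒩 {S = S} sat S∉F =
    [ flip contradiction S∉F , id ] (proj₂ (proj₂ (to saturated⇔ sat)) S)

  saturated? : (F : Family n) → Dec (IsSaturated F)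
  saturated? F = map′ (from saturated⇔) (to saturated⇔)
    (unique? F ×-dec ¬? (has𝒩? F) ×-dec searchable⇒all? anySubset? (λ S → S ∈? F ⊎-dec has𝒩? (S ∷ F)))

  SaturatedOfLength : ℕ → Set
  SaturatedOfLength k = Σ (Family n) λ F → IsSaturated F × length F ≡ k

  saturatedOfLength? : ∀ k → Dec (SaturatedOfLength k)
  saturatedOfLength? k = map′ (λ (v , sat) → toList v , sat , Vec.length-toList v) fromFamily
    (vec-searchable anySubset? k (saturated? ∘ toList))
    where
    fromFamily : SaturatedOfLength k → ∃ λ (v : Vec (Subset n) k) → IsSaturated (toList v)
    fromFamily (F , sat , refl) = fromList F , subst IsSaturated (sym (Vec.toList∘fromList F)) sat

-- Adding a clone of a member

module _ {n : ℕ} where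

  Alike : Subset n → Subset n → Subset n → Set
  Alike X Y T = (T ⊆ X ⇔ T ⊆ Y) × (X ⊆ T ⇔ Y ⊆ T)

  AlikeIn : Family n → Subset n → Subset n → Set
  AlikeIn F X Y = ∀ T → T ∈ F → T ≢ Y → Alike X Y T

  mkAlike : ∀ {X Y T} → (T ⊆ X → T ⊆ Y) → (T ⊆ Y → T ⊆ X) → (X ⊆ T → Y ⊆ T) → (Y ⊆ T → X ⊆ T) →
    Alike X Y T
  mkAlike below⇒ below⇐ above⇒ above⇐ = mk⇔ below⇒ below⇐ , mk⇔ above⇒ above⇐

  open import Relation.Binary.Reasoning.Setoid (⇔.⇔-setoid 0ℓ)

  alike⇒twins𝒩 : ∀ {f u v} → Induces𝒩 f →
    (∀ w → w ≢ u → w ≢ v → Alike (f u) (f v) (f w)) → Twins𝒩 u v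
  alike⇒twins𝒩 ind alike w w≢u w≢v =
    let (below , above) = alike w w≢u w≢v in
    ⇔.trans (ind w _) (⇔.trans below (⇔.sym (ind w _))) ,
    ⇔.trans (ind _ w) (⇔.trans above (⇔.sym (ind _ w)))

  induces𝒩-updateAt : ∀ {f u Y} → Induces𝒩 f → (∀ w → w ≢ u → Alike (f u) Y (f w)) →
    Induces𝒩 (updateAt f u (const Y))
  induces𝒩-updateAt {f} {u} {Y} ind alike a b with a Fin.≟ u | b Fin.≟ u
  ... | yes refl | yes refl = mk⇔ (λ _ {_} → id) (λ _ → refl𝒩)
  ... | yes refl | no b≢u = begin
    u ≤𝒩 b      ≈⟨ ind u b ⟩
    f u ⊆ f b   ≈⟨ proj₂ (alike b b≢u) ⟩
    Y ⊆ f b     ≈⟨ ⊆-cong (sym (updateAt-updates u f)) (sym (updateAt-minimal b u f b≢u)) ⟩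
    g u ⊆ g b   ∎
    where g = updateAt f u (const Y)
  ... | no a≢u | yes refl = begin
    a ≤𝒩 u      ≈⟨ ind a u ⟩
    f a ⊆ f u   ≈⟨ proj₁ (alike a a≢u) ⟩
    f a ⊆ Y     ≈⟨ ⊆-cong (sym (updateAt-minimal a u f a≢u)) (sym (updateAt-updates u f)) ⟩
    g a ⊆ g u   ∎
    where g = updateAt f u (const Y)
  ... | no a≢u | no b≢u = begin
    a ≤𝒩 b      ≈⟨ ind a b ⟩
    f a ⊆ f b   ≈⟨ ⊆-cong (sym (updateAt-minimal a u f a≢u)) (sym (updateAt-minimal b u f b≢u)) ⟩
    g a ⊆ g b   ∎
    where g = updateAt f u (const Y)

  adding-clone-keeps-𝒩-free : ∀ {F X Y} → ¬ HasInduced𝒩 F → Y ∈ F → X ∉ F →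
    X ⊆ Y ⊎ Y ⊆ X → AlikeIn F X Y → ¬ HasInduced𝒩 (X ∷ F)
  adding-clone-keeps-𝒩-free {F} {X} {Y} free Y∈F X∉F comparable alike (f , inj , f∈ , ind)
    with Fin.any? (λ u → f u ≟ˢ X)
  ... | no misses-X = free (f , inj , inF , ind)
    where
    inF : ∀ u → f u ∈ F
    inF u with f∈ u
    ... | here fu≡X = contradiction (u , fu≡X) misses-X
    ... | there fu∈F = fu∈F
  ... | yes (u , refl) = case Fin.any? (λ v → f v ≟ˢ Y) of λ
    { (yes (v , fv≡Y)) → twins-contradiction v fv≡Y
    ; (no misses-Y) → free (has𝒩 (replaced∈F misses-Y) (induces𝒩-updateAt ind (alike′ misses-Y)))
    }
    where
    others∈F : ∀ w → w ≢ u → f w ∈ F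
    others∈F w w≢u with f∈ w
    ... | here fw≡fu = contradiction (inj fw≡fu) w≢u
    ... | there fw∈F = fw∈F
    twins-contradiction : ∀ v → f v ≡ Y → ⊥
    twins-contradiction v refl =
      [ (λ (fu⊆fv : f u ⊆ f v) → comparable⇒¬twins𝒩 u≢v (from (ind u v) fu⊆fv) twins)
      , (λ (fv⊆fu : f v ⊆ f u) → comparable⇒¬twins𝒩 (u≢v ∘ sym) (from (ind v u) fv⊆fu) (twins𝒩-sym twins))
      ] comparable
      where
      u≢v : u ≢ v
      u≢v refl = X∉F Y∈F
      twins : Twins𝒩 u v
      twins = alike⇒twins𝒩 ind λ w w≢u w≢v → alike (f w) (others∈F w w≢u) (w≢v ∘ inj)
    alike′ : ¬ ∃ (λ v → f v ≡ Y) → ∀ w → w ≢ u → Alike (f u) Y (f w)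
    alike′ misses-Y w w≢u = alike (f w) (others∈F w w≢u) (misses-Y ∘ (w ,_))
    replaced∈F : ¬ ∃ (λ v → f v ≡ Y) → ∀ w → updateAt f u (const Y) w ∈ F
    replaced∈F misses-Y w with w Fin.≟ u
    ... | yes refl = subst (_∈ F) (sym (updateAt-updates u f)) Y∈F
    ... | no w≢u = subst (_∈ F) (sym (updateAt-minimal w u f w≢u)) (others∈F w w≢u)

-- Saturated families separate points

module _ {n : ℕ} where

  ¬has𝒩-singleton : ∀ {S : Subset n} → ¬ HasInduced𝒩 (S ∷ [])
  ¬has𝒩-singleton (f , inj , f∈ , _) with f∈ A | f∈ B
  ... | here fA≡S | here fB≡S with inj (trans fA≡S (sym fB≡S))
  ... | ()

  saturated⇒covering : ∀ {F} → IsSaturated F → ∀ i → Any (i ∈ˢ_) F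
  saturated⇒covering {[]} sat i = ⊥-elim (¬has𝒩-singleton (saturated⇒adding-creates𝒩 {S = ⊥ˢ} sat λ ()))
  saturated⇒covering {F@(T₁ ∷ _)} sat@(_ , free , _) i with any? (i ∈ˢ?_) F
  ... | yes covered = covered
  ... | no uncovered =
    ⊥-elim (adding-clone-keeps-𝒩-free free T₀∈F S∉F (inj₂ T₀⊆S) alike (saturated⇒adding-creates𝒩 sat S∉F))
    where
    open Σ (maximal-member ∣_∣ {xs = F} (here refl)) renaming (proj₁ to T₀; proj₂ to T₀-maximal)
    T₀∈F = proj₁ T₀-maximal
    S = T₀ ∪ ⁅ i ⁆
    S∉F : S ∉ F
    S∉F S∈F = uncovered (lose S∈F (x∈p∪q⁺ (inj₂ (x∈⁅x⁆ i))))
    T₀⊆S : T₀ ⊆ S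
    T₀⊆S = p⊆p∪q ⁅ i ⁆
    alike : AlikeIn F S T₀
    alike T T∈F T≢T₀ = mkAlike T⊆S⇒T⊆T₀ (λ T⊆T₀ → ⊆-trans T⊆T₀ T₀⊆S) (⊆-trans T₀⊆S) T₀⊆T⇒S⊆T
      where
      T⊆S⇒T⊆T₀ : T ⊆ S → T ⊆ T₀
      T⊆S⇒T⊆T₀ T⊆S {x} x∈T with x∈p∪q⁻ T₀ ⁅ i ⁆ (T⊆S x∈T)
      ... | inj₁ x∈T₀ = x∈T₀
      ... | inj₂ x∈⁅i⁆ = contradiction (lose T∈F (subst (_∈ˢ T) (x∈⁅y⁆⇒x≡y i x∈⁅i⁆) x∈T)) uncovered
      T₀⊆T⇒S⊆T : T₀ ⊆ T → S ⊆ T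
      T₀⊆T⇒S⊆T T₀⊆T = contradiction (proj₂ T₀-maximal T∈F) (ℕ.<⇒≱ (p⊂q⇒∣p∣<∣q∣ (p⊆q∧p≢q⇒p⊂q T₀⊆T (T≢T₀ ∘ sym))))

  Twins : Family n → Fin n → Fin n → Set
  Twins F i j = ∀ T → T ∈ F → lookup T i ≡ lookup T j

  twin-∈ : ∀ {T : Subset n} {i j} → lookup T i ≡ lookup T j → i ∈ˢ T → j ∈ˢ T
  twin-∈ {T} {i} {j} Ti≡Tj i∈T = Vec.lookup⇒[]= j T (trans (sym Ti≡Tj) (Vec.[]=⇒lookup i∈T))

  saturated⇒separating : ∀ {F} → IsSaturated F → ∀ i j → Twins F i j → i ≡ j
  saturated⇒separating {F} sat@(_ , free , _) i j twins with i Fin.≟ j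
  ... | yes i≡j = i≡j
  ... | no i≢j =
    ⊥-elim (adding-clone-keeps-𝒩-free free T₀∈F S∉F (inj₁ S⊆T₀) alike (saturated⇒adding-creates𝒩 sat S∉F))
    where
    open Σ (minimal-member ∣_∣ (i ∈ˢ?_) (saturated⇒covering sat i))
      renaming (proj₁ to T₀; proj₂ to T₀-minimal)
    T₀∈F = proj₁ T₀-minimal
    S = T₀ ∩ ∁ ⁅ i ⁆
    S⊆T₀ : S ⊆ T₀
    S⊆T₀ = p∩q⊆p T₀ (∁ ⁅ i ⁆)
    i∉S : i ∉ˢ S
    i∉S i∈S = x∈∁p⇒x∉p (proj₂ (x∈p∩q⁻ T₀ (∁ ⁅ i ⁆) i∈S)) (x∈⁅x⁆ i)
    ∈S : ∀ {x} → x ∈ˢ T₀ → x ≢ i → x ∈ˢ S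
    ∈S x∈T₀ x≢i = x∈p∩q⁺ (x∈T₀ , x∉p⇒x∈∁p (x≢y⇒x∉⁅y⁆ x≢i))
    j∈S : j ∈ˢ S
    j∈S = ∈S (twin-∈ (twins T₀ T₀∈F) (proj₁ (proj₂ T₀-minimal))) (i≢j ∘ sym)
    S∉F : S ∉ F
    S∉F S∈F = i∉S (twin-∈ (sym (twins S S∈F)) j∈S)
    alike : AlikeIn F S T₀
    alike T T∈F T≢T₀ = mkAlike (λ T⊆S → ⊆-trans T⊆S S⊆T₀) T⊆T₀⇒T⊆S S⊆T⇒T₀⊆T (⊆-trans S⊆T₀)
      where
      T⊆T₀⇒T⊆S : T ⊆ T₀ → T ⊆ S
      T⊆T₀⇒T⊆S T⊆T₀ {x} x∈T with x Fin.≟ i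
      ... | yes refl = contradiction (proj₂ (proj₂ T₀-minimal) T∈F x∈T)
                                     (ℕ.<⇒≱ (p⊂q⇒∣p∣<∣q∣ (p⊆q∧p≢q⇒p⊂q T⊆T₀ T≢T₀)))
      ... | no x≢i = ∈S (T⊆T₀ x∈T) x≢i
      S⊆T⇒T₀⊆T : S ⊆ T → T₀ ⊆ T
      S⊆T⇒T₀⊆T S⊆T {x} x∈T₀ with x Fin.≟ i
      ... | yes refl = twin-∈ (sym (twins T T∈F)) (S⊆T j∈S)
      ... | no x≢i = S⊆T (∈S x∈T₀ x≢i)

  separating⇒≤2^length : ∀ (F : Family n) → (∀ i j → Twins F i j → i ≡ j) → n ≤ 2 ^ length F
  separating⇒≤2^length F separating = Fin.injective⇒≤ signature-injective
    where
    bit : Bool ↣ Fin 2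
    bit = ↔⇒↣ (↔-sym 2↔Bool)
    signature : Fin n → Fin (2 ^ length F)
    signature i = funToFin λ k → Injection.to bit (lookup (List.lookup F k) i)
    signature-injective : Injective _≡_ _≡_ signature
    signature-injective {i} {j} sᵢ≡sⱼ = separating i j λ T T∈F →
      subst (λ T → lookup T i ≡ lookup T j) (sym (lookup-index T∈F))
        (Injection.injective bit (begin
          _ ≡⟨ finToFun-funToFin _ (Any.index T∈F) ⟨
          finToFun (signature i) (Any.index T∈F) ≡⟨ cong (λ s → finToFun s (Any.index T∈F)) sᵢ≡sⱼ ⟩
          finToFun (signature j) (Any.index T∈F) ≡⟨ finToFun-funToFin _ (Any.index T∈F) ⟩
          _ ∎))
      where open ≡-Reasoning

saturated⇒⌈log₂⌉≤length : ∀ {n} (F : Family n) → IsSaturated F → ⌈log₂ n ⌉ ≤ length F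
saturated⇒⌈log₂⌉≤length {n} F sat = begin
  ⌈log₂ n ⌉                  ≤⟨ ⌈log₂⌉-mono-≤ (separating⇒≤2^length F (saturated⇒separating sat)) ⟩
  ⌈log₂ (2 ^ length F) ⌉    ≡⟨ ⌈log₂2^n⌉≡n (length F) ⟩
  length F                  ∎
  where open ℕ.≤-Reasoning

-- A saturated family of size 2n

module _ (n : ℕ) where

  prefixesAndSingletons : Family (suc n)
  prefixesAndSingletons = applyUpTo prefix (2 + n) ++ tabulate (⁅_⁆ ∘ Fin.suc)

  length-prefixesAndSingletons : length prefixesAndSingletons ≡ 2 * suc n
  length-prefixesAndSingletons = begin
    length prefixesAndSingletons
      ≡⟨ List.length-++ (applyUpTo prefix (2 + n)) ⟩
    length (applyUpTo prefix (2 + n)) + length (tabulate (⁅_⁆ ∘ Fin.suc {n}))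
      ≡⟨ cong₂ _+_ (List.length-applyUpTo prefix (2 + n)) (List.length-tabulate (⁅_⁆ ∘ Fin.suc)) ⟩
    2 + n + n
      ≡⟨ cong suc (ℕ.+-suc n n) ⟨
    suc n + suc n
      ≡⟨ cong (suc n +_) (ℕ.+-identityʳ (suc n)) ⟨
    2 * suc n
      ∎
    where open ≡-Reasoning

  prefix∈ : ∀ {k} → k ≤ suc n → prefix k ∈ prefixesAndSingletons
  prefix∈ k≤1+n = ∈-++⁺ˡ (∈-applyUpTo⁺ prefix (s≤s k≤1+n))

  singleton∈ : ∀ x → ⁅ Fin.suc x ⁆ ∈ prefixesAndSingletons
  singleton∈ x = ∈-++⁺ʳ (applyUpTo prefix (2 + n)) (∈-tabulate⁺ x)

  prefix-or-singleton : ∀ {T} → T ∈ prefixesAndSingletons → (∃ λ k → T ≡ prefix k) ⊎ (∃ λ x → T ≡ ⁅ Fin.suc x ⁆)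
  prefix-or-singleton T∈ with ∈-++⁻ (applyUpTo prefix (2 + n)) T∈
  ... | inj₁ T∈prefixes = let (k , _ , T≡) = ∈-applyUpTo⁻ prefix T∈prefixes in inj₁ (k , T≡)
  ... | inj₂ T∈singletons = inj₂ (∈-tabulate⁻ T∈singletons)

  prefix-injective : ∀ {i j} → i < j → j ≤ suc n → prefix {suc n} i ≢ prefix j
  prefix-injective {i} {j} i<j j≤1+n prefixᵢ≡prefixⱼ = ℕ.<-irrefl (Fin.toℕ-fromℕ< i<1+n) (x∈prefix⁻ x∈prefixᵢ)
    where
    i<1+n = ℕ.<-≤-trans i<j j≤1+n
    x = fromℕ< i<1+n
    x∈prefixᵢ : x ∈ˢ prefix i
    x∈prefixᵢ = subst (x ∈ˢ_) (sym prefixᵢ≡prefixⱼ) (x∈prefix⁺ (subst (_< j) (sym (Fin.toℕ-fromℕ< i<1+n)) i<j))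

  prefix≢singleton : ∀ k x → prefix {suc n} k ≢ ⁅ Fin.suc x ⁆
  prefix≢singleton k x prefix≡⁅x⁆
    with x∈prefix⁻ {k = k} (subst (Fin.suc x ∈ˢ_) (sym prefix≡⁅x⁆) (x∈⁅x⁆ (Fin.suc x)))
  ... | s≤s _ with x∈⁅y⁆⇒x≡y (Fin.suc x) (subst (Fin.zero ∈ˢ_) prefix≡⁅x⁆ (x∈prefix⁺ (s≤s z≤n)))
  ... | ()

  prefixesAndSingletons-unique : Unique prefixesAndSingletons
  prefixesAndSingletons-unique =
    Unique.++⁺ (Unique.applyUpTo⁺₁ prefix (2 + n) λ i<j j<2+n → prefix-injective i<j (ℕ.≤-pred j<2+n))
               (Unique.tabulate⁺ singleton-injective)
               disjoint
    where
    singleton-injective : ∀ {x y : Fin n} → ⁅ Fin.suc x ⁆ ≡ ⁅ Fin.suc y ⁆ → x ≡ y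
    singleton-injective {x} ⁅x⁆≡⁅y⁆ = Fin.suc-injective (x∈⁅y⁆⇒x≡y _ (subst (Fin.suc x ∈ˢ_) ⁅x⁆≡⁅y⁆ (x∈⁅x⁆ _)))
    disjoint : ∀ {T} → ¬ (T ∈ applyUpTo prefix (2 + n) × T ∈ tabulate (⁅_⁆ ∘ Fin.suc))
    disjoint (T∈prefixes , T∈singletons) with ∈-applyUpTo⁻ prefix T∈prefixes | ∈-tabulate⁻ T∈singletons
    ... | k , _ , T≡prefix | x , T≡⁅x⁆ = prefix≢singleton k x (trans (sym T≡prefix) T≡⁅x⁆)

  strict-superset⇒prefix : ∀ {X T} {z : Fin (suc n)} → z ∈ˢ X → T ∈ prefixesAndSingletons →
    X ⊆ T → T ⊈ X → ∃ λ k → T ≡ prefix k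
  strict-superset⇒prefix {X} z∈X T∈ X⊆T T⊈X with prefix-or-singleton T∈
  ... | inj₁ prefixed = prefixed
  ... | inj₂ (x , refl) = ⊥-elim (T⊈X ⁅x⁆⊆X)
    where
    ⁅x⁆⊆X : ⁅ Fin.suc x ⁆ ⊆ X
    ⁅x⁆⊆X y∈⁅x⁆ =
      subst (_∈ˢ X) (trans (x∈⁅y⁆⇒x≡y (Fin.suc x) (X⊆T z∈X)) (sym (x∈⁅y⁆⇒x≡y (Fin.suc x) y∈⁅x⁆))) z∈X

  prefixesAndSingletons-𝒩-free : ¬ HasInduced𝒩 prefixesAndSingletons
  prefixesAndSingletons-𝒩-free (f , _ , f∈ , ind) with nonempty? (f C)
  ... | no empty with from (ind C A) (λ x∈fC → contradiction (_ , x∈fC) empty)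
  ...   | ()
  prefixesAndSingletons-𝒩-free (f , _ , f∈ , ind) | yes (z , z∈fC)
    with strict-superset⇒prefix z∈fC (f∈ B) (to (ind C B) C<B) (λ fB⊆fC → case from (ind B C) fB⊆fC of λ ())
       | strict-superset⇒prefix z∈fC (f∈ D) (to (ind C D) C<D) (λ fD⊆fC → case from (ind D C) fD⊆fC of λ ())
  ... | a , fB≡prefix | b , fD≡prefix with prefix-chain a b
  ...   | inj₁ prefix⊆prefix with from (ind B D) (subst₂ _⊆_ (sym fB≡prefix) (sym fD≡prefix) prefix⊆prefix)
  ...     | ()
  prefixesAndSingletons-𝒩-free (f , _ , f∈ , ind) | yes _ | a , fB≡prefix | b , fD≡prefix | inj₂ prefix⊆prefix
    with from (ind D B) (subst₂ _⊆_ (sym fD≡prefix) (sym fB≡prefix) prefix⊆prefix)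
  ... | ()

  pair⇒has𝒩 : ∀ {S} {x : Fin n} {y} → Fin.zero ∉ˢ S → Fin.suc x ∈ˢ S → y ∈ˢ S → Fin.suc x Fin.< y →
    HasInduced𝒩 (S ∷ prefixesAndSingletons)
  pair⇒has𝒩 {S} {x} {y} 0∉S x̂∈S y∈S x̂<y =
    has𝒩-from {a = prefix 1} {b = prefix (suc (toℕ x̂))} {c = ⁅ x̂ ⁆} {d = S}
      (there (prefix∈ (s≤s z≤n))) (there (prefix∈ (Fin.toℕ<n x̂))) (there (singleton∈ x)) (here refl)
      (prefix-mono (s≤s z≤n)) (x∈p⇒⁅x⁆⊆p x̂∈b) (x∈p⇒⁅x⁆⊆p x̂∈S)
      (∈∧∉⇒⊈ 0∈prefix 0∉⁅x̂⁆) (∈∧∉⇒⊈ 0∈prefix 0∉S)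
      (∈∧∉⇒⊈ x̂∈b x̂∉prefix1) (∈∧∉⇒⊈ 0∈prefix 0∉⁅x̂⁆) (∈∧∉⇒⊈ 0∈prefix 0∉S)
      (∈∧∉⇒⊈ (x∈⁅x⁆ x̂) x̂∉prefix1)
      (∈∧∉⇒⊈ x̂∈S x̂∉prefix1) (∈∧∉⇒⊈ y∈S y∉b) (∈∧∉⇒⊈ y∈S (x≢y⇒x∉⁅y⁆ y≢x̂))
    where
    x̂ = Fin.suc x
    0∈prefix : ∀ {k} → Fin.zero ∈ˢ prefix {suc n} (suc k)
    0∈prefix = x∈prefix⁺ (s≤s z≤n)
    0∉⁅x̂⁆ : Fin.zero ∉ˢ ⁅ x̂ ⁆
    0∉⁅x̂⁆ = x≢y⇒x∉⁅y⁆ {y = x̂} λ ()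
    x̂∈b : x̂ ∈ˢ prefix (suc (toℕ x̂))
    x̂∈b = x∈prefix⁺ (ℕ.n<1+n _)
    x̂∉prefix1 : x̂ ∉ˢ prefix 1
    x̂∉prefix1 x̂∈prefix1 with x∈prefix⁻ {k = 1} x̂∈prefix1
    ... | s≤s ()
    y∉b : y ∉ˢ prefix (suc (toℕ x̂))
    y∉b y∈b = ℕ.<⇒≱ x̂<y (ℕ.≤-pred (x∈prefix⁻ y∈b))
    y≢x̂ : y ≢ x̂
    y≢x̂ y≡x̂ = ℕ.<-irrefl (cong toℕ (sym y≡x̂)) x̂<y

  gap⇒has𝒩 : ∀ {S} {j : Fin n} {m} → Fin.suc j ∉ˢ S → m ∈ˢ S → Fin.suc j Fin.< m →
    prefix (toℕ (Fin.suc j)) ⊆ S → HasInduced𝒩 (S ∷ prefixesAndSingletons)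
  gap⇒has𝒩 {S} {j} {Fin.suc m} ĵ∉S m̂∈S ĵ<m̂ prefix⊆S =
    has𝒩-from {a = ⁅ m̂ ⁆} {b = S} {c = prefix J} {d = prefix (suc J)}
      (there (singleton∈ m)) (here refl) (there (prefix∈ (ℕ.<⇒≤ (Fin.toℕ<n ĵ)))) (there (prefix∈ (Fin.toℕ<n ĵ)))
      (x∈p⇒⁅x⁆⊆p m̂∈S) prefix⊆S (prefix-mono (ℕ.n≤1+n J))
      (∈∧∉⇒⊈ (x∈⁅x⁆ m̂) m̂∉c) (∈∧∉⇒⊈ (x∈⁅x⁆ m̂) m̂∉d)
      (∈∧∉⇒⊈ (prefix⊆S 0∈c) 0∉⁅m̂⁆) (∈∧∉⇒⊈ m̂∈S m̂∉c) (∈∧∉⇒⊈ m̂∈S m̂∉d)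
      (∈∧∉⇒⊈ 0∈c 0∉⁅m̂⁆)
      (∈∧∉⇒⊈ (prefix-mono (ℕ.n≤1+n J) 0∈c) 0∉⁅m̂⁆) (∈∧∉⇒⊈ ĵ∈d ĵ∉S) (∈∧∉⇒⊈ ĵ∈d (ℕ.<-irrefl refl ∘ x∈prefix⁻))
    where
    ĵ = Fin.suc j
    m̂ = Fin.suc m
    J = toℕ ĵ
    0∈c : Fin.zero ∈ˢ prefix J
    0∈c = x∈prefix⁺ (s≤s z≤n)
    0∉⁅m̂⁆ : Fin.zero ∉ˢ ⁅ m̂ ⁆
    0∉⁅m̂⁆ = x≢y⇒x∉⁅y⁆ {y = m̂} λ ()
    ĵ∈d : ĵ ∈ˢ prefix (suc J)
    ĵ∈d = x∈prefix⁺ (ℕ.n<1+n J)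
    m̂∉c : m̂ ∉ˢ prefix J
    m̂∉c = ℕ.<-asym ĵ<m̂ ∘ x∈prefix⁻
    m̂∉d : m̂ ∉ˢ prefix (suc J)
    m̂∉d = ℕ.<⇒≱ ĵ<m̂ ∘ ℕ.≤-pred ∘ x∈prefix⁻

  prefixesAndSingletons-adding-creates𝒩 : AddingCreates𝒩 prefixesAndSingletons
  prefixesAndSingletons-adding-creates𝒩 S with prefix-or-gap S
  ... | inj₁ (k , k≤1+n , refl) = inj₁ (prefix∈ k≤1+n)
  ... | inj₂ (Fin.suc j , m , ĵ∉S , m∈S , ĵ<m , prefix⊆S) = inj₂ (gap⇒has𝒩 ĵ∉S m∈S ĵ<m prefix⊆S)
  ... | inj₂ (Fin.zero , _ , 0∉S , _) with empty-or-singleton-or-pair S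
  ...   | inj₁ refl = inj₁ (prefix∈ z≤n)
  ...   | inj₂ (inj₁ (Fin.zero , refl)) = contradiction hereˢ 0∉S
  ...   | inj₂ (inj₁ (Fin.suc x , refl)) = inj₁ (singleton∈ x)
  ...   | inj₂ (inj₂ (Fin.zero , _ , 0∈S , _)) = contradiction 0∈S 0∉S
  ...   | inj₂ (inj₂ (Fin.suc x , y , x̂∈S , y∈S , x̂<y)) = inj₂ (pair⇒has𝒩 0∉S x̂∈S y∈S x̂<y)

  prefixesAndSingletons-saturated : IsSaturated prefixesAndSingletons
  prefixesAndSingletons-saturated = from saturated⇔
    (prefixesAndSingletons-unique , prefixesAndSingletons-𝒩-free , prefixesAndSingletons-adding-creates𝒩)

  prefixesAndSingletons-saturatedOfLength : SaturatedOfLength (2 * suc n)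
  prefixesAndSingletons-saturatedOfLength =
    prefixesAndSingletons , prefixesAndSingletons-saturated , length-prefixesAndSingletons

theorem6 : ∀ (n : ℕ) → 3 ≤ n →
    Σ ℕ λ m → IsSatStar n m × (⌈log₂ n ⌉ ≤ m × m ≤ 2 * n)
theorem6 (suc n) _ =
  let construction = prefixesAndSingletons-saturatedOfLength n
      (m , smallest , least) = least-witness saturatedOfLength? construction
      (F , F-saturated , F-length) = smallest
  in m , (smallest , λ G G-saturated → least (G , G-saturated , refl)) ,
     subst (⌈log₂ suc n ⌉ ≤_) F-length (saturated⇒⌈log₂⌉≤length F F-saturated) ,
     least construction
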